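{- Let $(N,\mathcal{W})$ be a complete simple game with $n$ players and $t$ equivalence classes $N_1,\dots,N_t$ ordered by decreasing desirability, $n_j=|N_j|$. If $(n_1-1,\dots,n_t-1)$ is a winning coalition vector, then $$\nu(N,\mathcal{W})\le\max_{1\le i\le t}\left\lceil\frac{\sum_{j=1}^i n_j}{i}\right\rceil\le n-t+1.$$
   Context: A simple game $(N,\mathcal{W})$: $N$ finite, $\mathcal{W}$ a family of subsets (winning coalitions) with $\emptyset\notin\mathcal{W}$, $N\in\mathcal{W}$, closed under supersets; $\nu(N,\mathcal{W})$ is the minimum number of winning coalitions with empty intersection. Write $i\sqsupseteq j$ if for every $S$ with $j\in S\subseteq N\setminus\{i\}$, $S\in\mathcal{W}$ implies $(S\setminus\{j\})\cup\{i\}\in\mathcal{W}$. The game is complete if $\sqsupseteq$ is a total preorder; its equivalence classes $N_1,\dots,N_t$ are ordered so that players in $N_a$ are strictly more desirable than those in $N_b$ for $a<b$. The coalition vector of $S$ is $(|S\cap N_1|,\dots,|S\cap N_t|)$; a coalition vector is winning if the corresponding coalitions are winning. -}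

module Defs where

open import Data.Nat using (ℕ; zero; suc; _+_; _∸_; _≤_; _⊔_; _/_)
open import Data.Fin using (Fin; toℕ)
import Data.Fin as F
open import Data.Fin.Subset using (Subset; _∈_; _∉_; _⊆_; ⊥; ⊤; ∣_∣; _∩_; _∪_; _─_; ⁅_⁆)
open import Data.Bool using (Bool; true; false)
open import Data.Vec using (tabulate)
open import Data.List using (List; length; foldr; map; upTo)
open import Data.List.Relation.Unary.All using (All)
open import Data.Product using (Σ; _×_)
open import Relation.Binary.PropositionalEquality using (_≡_)
open import Relation.Nullary.Decidable using (⌊_⌋)

record SimpleGame (n : ℕ) : Set where
  field
    W             : Subset n → Bool
    empty-losing  : W ⊥ ≡ false
    grand-winning : W ⊤ ≡ true
    superset-closed : ∀ S T → S ⊆ T → W S ≡ true → W T ≡ true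

module _ {n : ℕ} (G : SimpleGame n) where
  open SimpleGame G

  Winning : Subset n → Set
  Winning S = W S ≡ true

  Desirable : Fin n → Fin n → Set
  Desirable i j = ∀ S → j ∈ S → i ∉ S → Winning S → Winning ((S ─ ⁅ j ⁆) ∪ ⁅ i ⁆)

  ⋂ : List (Subset n) → Subset n
  ⋂ = foldr _∩_ ⊤

  IsNu : ℕ → Set
  IsNu k =
    (Σ (List (Subset n)) λ Ss → length Ss ≡ k × All Winning Ss × ⋂ Ss ≡ ⊥)
    × (∀ (Ss : List (Subset n)) → All Winning Ss → ⋂ Ss ≡ ⊥ → k ≤ length Ss)

-- Given a labelling cls : Fin n → Fin t of players by their equivalence class
-- (class index 0 = most desirable):
module _ {n t : ℕ} (cls : Fin n → Fin t) where

  classSet : Fin t → Subset n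
  classSet j = tabulate (λ i → ⌊ cls i F.≟ j ⌋)

  classSize : Fin t → ℕ
  classSize j = ∣ classSet j ∣

  coalitionVector : Subset n → Fin t → ℕ
  coalitionVector S j = ∣ S ∩ classSet j ∣

  prefixSum : ℕ → ℕ
  prefixSum k = foldr _+_ 0 (map (λ j → classSize j) (Data.List.filter (λ j → toℕ j Data.Nat.<? k) (Data.List.allFin t)))

  -- ⌈ a / b ⌉ for b ≥ 1
  ceilDiv : ℕ → ℕ → ℕ
  ceilDiv a b = (a + b ∸ 1) / suc (b ∸ 1)

  maxBound : ℕ
  maxBound = foldr _⊔_ 0 (map (λ k → ceilDiv (prefixSum (suc k)) (suc k)) (upTo t))

WinningVector : {n t : ℕ} → SimpleGame n → (Fin n → Fin t) → (Fin t → ℕ) → Set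
WinningVector G cls v = ∀ S → (∀ j → coalitionVector cls S j ≡ v j) → Winning G S

-- Let k = maxBound, so the first i classes contain at most k·i players.  Greedily colour
-- the players with k colours so that every colour occurs at most i times among the first
-- i classes.  The complement S of a colour class then misses at most i players from the
-- first i classes, and every such S is winning: dropping a player from S, or exchanging
-- one for a less desirable absent player, preserves this property and strictly decreases
-- a weight, until S misses exactly one player per class; desirability carries winning
-- back along the moves.  The k complements have empty intersection, so ν ≤ k.  As every
-- class is nonempty, the first i classes hold at most n − t + i ≤ (n − t + 1)·i players.
module Submission where

open import Defs
open import Data.Nat using (ℕ; _≤_; _∸_; _+_)
open import Data.Fin using (Fin)
open import Data.Product using (Σ; _×_)
open import Function.Bundles using (_⇔_; mk⇔; module Equivalence)
open import Function.Definitions using (Surjective)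
open import Relation.Binary.Structures using (IsTotalPreorder)
open import Relation.Binary.PropositionalEquality using (_≡_)

open import Data.Nat using (zero; suc; _*_; _<_; _⊔_; _/_; _%_; z≤n; s≤s; _<?_; _≤?_)
open import Data.Nat.DivMod using (m≡m%n+[m/n]*n; m%n<n; m<n*o⇒m/o<n)
import Data.Nat as ℕ
open import Data.Nat.Properties
open import Data.Nat.Induction using (<-wellFounded)
open import Data.Fin using (toℕ; fromℕ<; punchIn) renaming (zero to fzero; suc to fsuc)
import Data.Fin as Fin
import Data.Fin.Properties as Fin
open import Data.Fin.Subset using (Subset; _∈_; _∉_; _⊆_; ⁅_⁆; _─_; _∪_; _∩_; ∣_∣; ⊤; ⊥)
open import Data.Fin.Subset.Properties using (Empty-unique; x∈p∩q⁻; x∈p∪q⁻; x∈⁅y⁆⇒x≡y; x∈⁅x⁆; anySubset?; ∩-assoc; ∩-identityˡ)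
open import Data.Vec using ([]; _∷_; lookup; tabulate; _[_]≔_; here; there)
open import Data.Vec.Properties using (lookup∘update; lookup∘update′; []=⇒lookup; lookup⇒[]=; lookup-zipWith; lookup∘tabulate; ≡-dec)
open import Data.Vec.Functional using (removeAt; insertAt)
open import Data.Vec.Functional.Properties using (insertAt-lookup; insertAt-punchIn)
open import Data.Bool using (Bool; true; false; not; _∧_; if_then_else_)
import Data.Bool as Bool
open import Data.Bool.Properties using (¬-not; not-involutive)
open import Data.List using (List; []; _∷_; length; allFin; foldr; map; filter; upTo)
import Data.List as List
open import Data.List.Properties using (length-map; length-tabulate; map-tabulate; foldr-preservesᵇ; foldr-preservesᵒ)
import Data.List.Relation.Unary.All.Properties as Allₚ
import Data.List.Relation.Unary.Any as Any
import Data.List.Relation.Unary.Any.Properties as Anyₚ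
open import Data.List.Extrema.Nat using (argmax; f[xs]≤f[argmax])
open import Data.List.Relation.Unary.All as All using (All; []; _∷_)
open import Data.List.Membership.Propositional using () renaming (_∈_ to _∈ₗ_)
open import Data.List.Membership.Propositional.Properties using (∈-allFin; ∈-map⁺)
open import Data.Product using (∃; _,_; proj₁; proj₂)
open import Data.Sum using (_⊎_; inj₁; inj₂; [_,_]′)
open import Function using (_∘_)
import Induction.WellFounded as WF
import Relation.Binary.Construct.On as On
open import Relation.Binary using (tri<; tri≈; tri>)
open import Relation.Nullary using (Dec; yes; no; ¬_; does; contradiction)
open import Relation.Nullary.Decidable using (isYes; _×-dec_)
open import Relation.Unary using (Pred; Decidable)
open import Relation.Binary.PropositionalEquality

open import Algebra.Properties.Semiring.Sum +-*-semiring
  using (sum; sum-cong-≗; ∑-distrib-+; ∑-comm; sum-remove; *-distribˡ-sum)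

bit : Bool → ℕ
bit true  = 1
bit false = 0

𝟙 : ∀ {a} {A : Set a} → Dec A → ℕ
𝟙 = bit ∘ does

module _ {a} {A : Set a} where

  𝟙-yes : (d : Dec A) → A → 𝟙 d ≡ 1
  𝟙-yes (yes _) _ = refl
  𝟙-yes (no ¬a) a = contradiction a ¬a

  𝟙-no : (d : Dec A) → ¬ A → 𝟙 d ≡ 0
  𝟙-no (yes a) ¬a = contradiction a ¬a
  𝟙-no (no _)  _  = refl

𝟙-mono : ∀ {a b} {A : Set a} {B : Set b} (d : Dec A) (e : Dec B) → (A → B) → 𝟙 d ≤ 𝟙 e
𝟙-mono (yes a) e f = ≤-reflexive (sym (𝟙-yes e (f a)))
𝟙-mono (no _)  e f = z≤n

𝟙-cong : ∀ {a b} {A : Set a} {B : Set b} (d : Dec A) (e : Dec B) → (A → B) → (B → A) → 𝟙 d ≡ 𝟙 e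
𝟙-cong d e f g = ≤-antisym (𝟙-mono d e f) (𝟙-mono e d g)

𝟙*-≤ : ∀ {a} {A : Set a} (d : Dec A) x → 𝟙 d * x ≤ x
𝟙*-≤ (yes _) x = ≤-reflexive (+-identityʳ x)
𝟙*-≤ (no _)  x = z≤n

bit-isYes : ∀ {a} {A : Set a} (d : Dec A) → bit (isYes d) ≡ 𝟙 d
bit-isYes (yes _) = refl
bit-isYes (no _)  = refl

bit-∧-split : ∀ b c → bit (b ∧ c) + bit c * bit (not b) ≡ bit c
bit-∧-split true  true  = refl
bit-∧-split true  false = refl
bit-∧-split false true  = refl
bit-∧-split false false = refl

𝟙-<-suc : ∀ x q → 𝟙 (x <? suc q) ≡ 𝟙 (x <? q) + 𝟙 (x ℕ.≟ q)
𝟙-<-suc x q with <-cmp x q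
... | tri< x<q x≢q _ = trans (𝟙-yes (x <? suc q) (m<n⇒m<1+n x<q)) (sym (cong₂ _+_ (𝟙-yes (x <? q) x<q) (𝟙-no (x ℕ.≟ q) x≢q)))
... | tri≈ x≮q x≡q _ = trans (𝟙-yes (x <? suc q) (s≤s (≤-reflexive x≡q))) (sym (cong₂ _+_ (𝟙-no (x <? q) x≮q) (𝟙-yes (x ℕ.≟ q) x≡q)))
... | tri> x≮q x≢q q<x = trans (𝟙-no (x <? suc q) (<⇒≱ q<x ∘ ≤-pred)) (sym (cong₂ _+_ (𝟙-no (x <? q) x≮q) (𝟙-no (x ℕ.≟ q) x≢q)))

𝟙-<+𝟙-≥ : ∀ x s → 𝟙 (x <? s) + 𝟙 (s ≤? x) ≡ 1
𝟙-<+𝟙-≥ x s with x <? s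
... | yes x<s = cong₂ _+_ (𝟙-yes (x <? s) x<s) (𝟙-no (s ≤? x) (<⇒≱ x<s))
... | no x≮s  = cong₂ _+_ (𝟙-no (x <? s) x≮s) (𝟙-yes (s ≤? x) (≮⇒≥ x≮s))

sum-const : ∀ {n} c → sum {n} (λ _ → c) ≡ n * c
sum-const {zero}  c = refl
sum-const {suc n} c = cong (c +_) (sum-const {n} c)

sum-mono-≤ : ∀ {n} {f g : Fin n → ℕ} → (∀ p → f p ≤ g p) → sum f ≤ sum g
sum-mono-≤ {zero}  f≤g = z≤n
sum-mono-≤ {suc n} f≤g = +-mono-≤ (f≤g fzero) (sum-mono-≤ (f≤g ∘ fsuc))

≤-sum : ∀ {n} (f : Fin n → ℕ) p → f p ≤ sum f
≤-sum {suc n} f fzero    = m≤m+n _ _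
≤-sum {suc n} f (fsuc p) = ≤-trans (≤-sum (f ∘ fsuc) p) (m≤n+m _ _)

sum-𝟙-all : ∀ {n p} {P : Fin n → Set p} (P? : ∀ q → Dec (P q)) → (∀ q → P q) → sum (λ q → 𝟙 (P? q)) ≡ n
sum-𝟙-all {n} P? all = trans (sum-cong-≗ λ q → 𝟙-yes (P? q) (all q)) (trans (sum-const {n} 1) (*-identityʳ n))

sum-update : ∀ {n} (f g : Fin n → ℕ) z → (∀ p → p ≢ z → f p ≡ g p) →
             sum f + g z ≡ sum g + f z
sum-update {suc n} f g z f≡g = begin
  sum f + g z                             ≡⟨ cong (_+ g z) (sum-remove f) ⟩
  f z + sum (f ∘ punchIn z) + g z         ≡⟨ cong (λ s → f z + s + g z) (sum-cong-≗ λ q → f≡g _ (Fin.punchInᵢ≢i z q)) ⟩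
  f z + sum (g ∘ punchIn z) + g z         ≡⟨ +-assoc (f z) _ (g z) ⟩
  f z + (sum (g ∘ punchIn z) + g z)       ≡⟨ cong (f z +_) (+-comm _ (g z)) ⟩
  f z + (g z + sum (g ∘ punchIn z))       ≡⟨ cong (f z +_) (sum-remove g) ⟨
  f z + sum g                             ≡⟨ +-comm (f z) _ ⟩
  sum g + f z                             ∎
  where open ≡-Reasoning

sum-select : ∀ {n} (z : Fin n) (h : Fin n → ℕ) → sum (λ j → 𝟙 (z Fin.≟ j) * h j) ≡ h z
sum-select {suc n} z h = begin
  sum (λ j → 𝟙 (z Fin.≟ j) * h j)              ≡⟨ sum-remove {i = z} (λ j → 𝟙 (z Fin.≟ j) * h j) ⟩
  𝟙 (z Fin.≟ z) * h z + sum (λ q → 𝟙 (z Fin.≟ punchIn z q) * h (punchIn z q))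
      ≡⟨ cong₂ _+_ (cong (_* h z) (𝟙-yes (z Fin.≟ z) refl))
                   (sum-cong-≗ λ q → cong (_* h (punchIn z q)) (𝟙-no (z Fin.≟ punchIn z q) (Fin.punchInᵢ≢i z q ∘ sym))) ⟩
  1 * h z + sum {n} (λ _ → 0)                  ≡⟨ cong₂ _+_ (*-identityˡ (h z)) (trans (sum-const {n} 0) (*-zeroʳ n)) ⟩
  h z + 0                                      ≡⟨ +-identityʳ (h z) ⟩
  h z                                          ∎
  where open ≡-Reasoning

t∸s≤#[s≤] : ∀ t s → t ∸ s ≤ sum {t} λ j → 𝟙 (s ≤? toℕ j)
t∸s≤#[s≤] zero    s       = ≤-reflexive (0∸n≡0 s)
t∸s≤#[s≤] (suc t) zero    = ≤-reflexive (sym (sum-𝟙-all (λ j → 0 ≤? toℕ j) (λ _ → z≤n)))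
t∸s≤#[s≤] (suc t) (suc s) = begin
  t ∸ s                                      ≤⟨ t∸s≤#[s≤] t s ⟩
  sum {t} (λ j → 𝟙 (s ≤? toℕ j))
    ≡⟨ sum-cong-≗ {t} {λ j → 𝟙 (s ≤? toℕ j)} (λ j → 𝟙-cong (s ≤? toℕ j) (suc s ≤? suc (toℕ j)) s≤s ≤-pred) ⟩
  sum {t} (λ j → 𝟙 (suc s ≤? suc (toℕ j)))   ∎
  where open ≤-Reasoning

<-from-+≡ : ∀ {a b c d} → a + c ≡ b + d → d < c → a < b
<-from-+≡ {a} {b} {c} {d} eq d<c = +-cancelʳ-< c a b (subst (_< b + c) (sym eq) (+-monoʳ-< b d<c))

leastBelow : ∀ {p} {P : ℕ → Set p} → Decidable P → ∀ b →
  (∃ λ i → i < b × P i × (∀ {r} → r < i → ¬ P r)) ⊎ (∀ {r} → r < b → ¬ P r)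
leastBelow P? zero = inj₂ λ ()
leastBelow P? (suc b) with leastBelow P? b
... | inj₁ (i , i<b , Pi , least) = inj₁ (i , m<n⇒m<1+n i<b , Pi , least)
... | inj₂ none with P? b
...   | yes Pb = inj₁ (b , n<1+n b , Pb , none)
...   | no ¬Pb = inj₂ λ r<1+b → [ none , (λ { refl → ¬Pb }) ]′ (m<1+n⇒m<n∨m≡n r<1+b)

foldr-filter : ∀ {a p} {A : Set a} {P : Pred A p} (P? : Decidable P) (f : A → ℕ) xs →
  foldr _+_ 0 (map f (filter P? xs)) ≡ foldr _+_ 0 (map (λ x → 𝟙 (P? x) * f x) xs)
foldr-filter P? f []       = refl
foldr-filter P? f (x ∷ xs) with does (P? x)
... | true  = cong₂ _+_ (sym (+-identityʳ (f x))) (foldr-filter P? f xs)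
... | false = foldr-filter P? f xs

foldr-allFin : ∀ {t} (g : Fin t → ℕ) → foldr _+_ 0 (map g (allFin t)) ≡ sum g
foldr-allFin {t} g = trans (cong (foldr _+_ 0) (map-tabulate (λ j → j) g)) (go g)
  where
  go : ∀ {m} (h : Fin m → ℕ) → foldr _+_ 0 (List.tabulate h) ≡ sum h
  go {zero}  h = refl
  go {suc m} h = cong (h fzero +_) (go (h ∘ fsuc))

≤-max-upTo : ∀ (f : ℕ → ℕ) {r t} → r < t → f r ≤ foldr _⊔_ 0 (map f (upTo t))
≤-max-upTo f {r} r<t = foldr-preservesᵒ {P = f r ≤_} (λ x y → [ m≤n⇒m≤n⊔o y , m≤n⇒m≤o⊔n x ]′) 0 _
  (inj₂ (Anyₚ.map⁺ (Anyₚ.applyUpTo⁺ (λ i → i) ≤-refl r<t)))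

max-upTo-≤ : ∀ (f : ℕ → ℕ) t {m} → (∀ {r} → r < t → f r ≤ m) → foldr _⊔_ 0 (map f (upTo t)) ≤ m
max-upTo-≤ f t {m} f≤m = foldr-preservesᵇ {P = _≤ m} ⊔-lub z≤n (Allₚ.map⁺ (Allₚ.applyUpTo⁺₁ (λ i → i) t f≤m))

below : ∀ {n} → (Fin n → ℕ) → ℕ → ℕ
below ℓ i = sum λ p → 𝟙 (ℓ p <? i)

fibre : ∀ {n k} → (Fin n → Fin k) → Fin k → ℕ
fibre a c = sum λ p → 𝟙 (a p Fin.≟ c)

colouredBelow : ∀ {n k} → (Fin n → ℕ) → (Fin n → Fin k) → Fin k → ℕ → ℕ
colouredBelow ℓ a c i = sum λ p → 𝟙 (ℓ p <? i) * 𝟙 (a p Fin.≟ c)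

sum-fibre : ∀ {n k} (a : Fin n → Fin k) → sum (fibre a) ≡ n
sum-fibre {n} {k} a = begin
  sum (λ c → sum λ p → 𝟙 (a p Fin.≟ c))      ≡⟨ ∑-comm (λ p c → 𝟙 (a p Fin.≟ c)) ⟨
  sum (λ p → sum λ c → 𝟙 (a p Fin.≟ c))
    ≡⟨ sum-cong-≗ (λ p → trans (sum-cong-≗ λ c → sym (*-identityʳ (𝟙 (a p Fin.≟ c)))) (sum-select (a p) (λ _ → 1))) ⟩
  sum {n} (λ _ → 1)                          ≡⟨ trans (sum-const {n} 1) (*-identityʳ n) ⟩
  n                                          ∎
  where open ≡-Reasoning

pigeonhole : ∀ {n k m} (a : Fin n → Fin k) → n < k * m → ∃ λ c → fibre a c < m
pigeonhole {n} {k} {m} a n<km with Fin.any? (λ c → fibre a c <? m)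
... | yes small = small
... | no ¬small = contradiction n<km (≤⇒≯ (begin
  k * m                 ≡⟨ sum-const {k} m ⟨
  sum {k} (λ _ → m)     ≤⟨ sum-mono-≤ (λ c → ≮⇒≥ (¬small ∘ (c ,_))) ⟩
  sum (fibre a)         ≡⟨ sum-fibre a ⟩
  n                     ∎))
  where open ≤-Reasoning

colouredBelow≤fibre : ∀ {n k} (ℓ : Fin n → ℕ) (a : Fin n → Fin k) c i → colouredBelow ℓ a c i ≤ fibre a c
colouredBelow≤fibre ℓ a c i = sum-mono-≤ λ p → 𝟙*-≤ (ℓ p <? i) _

colouredBelow-insertAt : ∀ {n k} (ℓ : Fin (suc n) → ℕ) z (a : Fin n → Fin k) c′ c i →
  colouredBelow ℓ (insertAt a z c′) c i ≡ 𝟙 (ℓ z <? i) * 𝟙 (c′ Fin.≟ c) + colouredBelow (removeAt ℓ z) a c i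
colouredBelow-insertAt ℓ z a c′ c i = begin
  colouredBelow ℓ (insertAt a z c′) c i
    ≡⟨ sum-remove {i = z} (λ p → 𝟙 (ℓ p <? i) * 𝟙 (insertAt a z c′ p Fin.≟ c)) ⟩
  𝟙 (ℓ z <? i) * 𝟙 (insertAt a z c′ z Fin.≟ c) + sum (λ q → 𝟙 (ℓ (punchIn z q) <? i) * 𝟙 (insertAt a z c′ (punchIn z q) Fin.≟ c))
    ≡⟨ cong₂ _+_ (cong (λ x → 𝟙 (ℓ z <? i) * 𝟙 (x Fin.≟ c)) (insertAt-lookup a z c′))
                 (sum-cong-≗ λ q → cong (λ x → 𝟙 (ℓ (punchIn z q) <? i) * 𝟙 (x Fin.≟ c)) (insertAt-punchIn a z c′ q)) ⟩
  𝟙 (ℓ z <? i) * 𝟙 (c′ Fin.≟ c) + colouredBelow (removeAt ℓ z) a c i ∎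
  where open ≡-Reasoning

below-removeAt : ∀ {n} (ℓ : Fin (suc n) → ℕ) z i → below (removeAt ℓ z) i ≤ below ℓ i
below-removeAt ℓ z i = ≤-trans (m≤n+m _ _) (≤-reflexive (sym (sum-remove {i = z} (λ p → 𝟙 (ℓ p <? i)))))

maximiser : ∀ {n} (ℓ : Fin (suc n) → ℕ) → ∃ λ z → ∀ p → ℓ p ≤ ℓ z
maximiser {n} ℓ = argmax ℓ fzero (allFin (suc n)) ,
                  λ p → All.lookup (f[xs]≤f[argmax] {f = ℓ} fzero (allFin (suc n))) (∈-allFin p)

-- Greedy: a player z of largest label takes a colour used at most ℓ z times on the others.
colouring : ∀ {n} k (ℓ : Fin n → ℕ) → (∀ p → below ℓ (suc (ℓ p)) ≤ k * suc (ℓ p)) →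
            ∃ λ (a : Fin n → Fin k) → ∀ c i → colouredBelow ℓ a c i ≤ i
colouring {zero}  k ℓ hyp = (λ ()) , λ c i → z≤n
colouring {suc n} k ℓ hyp with maximiser ℓ
... | z , ℓ≤ℓz = insertAt a′ z c′ , bound
  where
  rest : ∃ λ (a′ : Fin n → Fin k) → ∀ c i → colouredBelow (removeAt ℓ z) a′ c i ≤ i
  rest = colouring k (removeAt ℓ z) λ q → ≤-trans (below-removeAt ℓ z (suc (ℓ (punchIn z q)))) (hyp (punchIn z q))
  a′ : Fin n → Fin k
  a′ = proj₁ rest
  few : ∃ λ c → fibre a′ c < suc (ℓ z)
  few = pigeonhole a′ (begin-strict
    n                          <⟨ n<1+n n ⟩
    suc n                      ≡⟨ sum-𝟙-all (λ p → ℓ p <? suc (ℓ z)) (s≤s ∘ ℓ≤ℓz) ⟨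
    below ℓ (suc (ℓ z))        ≤⟨ hyp z ⟩
    k * suc (ℓ z)              ∎)
    where open ≤-Reasoning
  c′ : Fin k
  c′ = proj₁ few
  bound : ∀ c i → colouredBelow ℓ (insertAt a′ z c′) c i ≤ i
  bound c i = begin
    colouredBelow ℓ (insertAt a′ z c′) c i                               ≡⟨ colouredBelow-insertAt ℓ z a′ c′ c i ⟩
    𝟙 (ℓ z <? i) * 𝟙 (c′ Fin.≟ c) + colouredBelow (removeAt ℓ z) a′ c i ≤⟨ withNewcomer (ℓ z <? i) (c′ Fin.≟ c) ⟩
    i                                                                    ∎
    where
    open ≤-Reasoning
    withNewcomer : (d : Dec (ℓ z < i)) (e : Dec (c′ ≡ c)) → 𝟙 d * 𝟙 e + colouredBelow (removeAt ℓ z) a′ c i ≤ i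
    withNewcomer (yes ℓz<i) (yes refl) = ≤-trans (s≤s (≤-trans (colouredBelow≤fibre _ a′ c′ i) (≤-pred (proj₂ few)))) ℓz<i
    withNewcomer (yes _)    (no _)     = proj₂ rest c i
    withNewcomer (no _)     _          = proj₂ rest c i

size≡sum : ∀ {n} (S : Subset n) → ∣ S ∣ ≡ sum (bit ∘ lookup S)
size≡sum []          = refl
size≡sum (true ∷ S)  = cong suc (size≡sum S)
size≡sum (false ∷ S) = size≡sum S

∈─⁻ : ∀ {n} (A B : Subset n) {p} → p ∈ A ─ B → p ∈ A × p ∉ B
∈─⁻ (true ∷ A)  (false ∷ B) here = here , λ ()
∈─⁻ (true ∷ A)  (true ∷ B) {Fin.zero} ()
∈─⁻ (false ∷ A) (true ∷ B)  {Fin.zero} ()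
∈─⁻ (false ∷ A) (false ∷ B) {Fin.zero} ()
∈─⁻ (_ ∷ A)     (_ ∷ B) (there p∈A─B) with ∈─⁻ A B p∈A─B
... | p∈A , p∉B = there p∈A , λ { (there p∈B) → p∉B p∈B }

sum-[]≔ : ∀ {n} (h : Fin n → Bool → ℕ) (S : Subset n) z b →
  sum (λ p → h p (lookup (S [ z ]≔ b) p)) + h z (lookup S z) ≡ sum (λ p → h p (lookup S p)) + h z b
sum-[]≔ h S z b = trans (sum-update _ _ z λ p p≢z → cong (h p) (lookup∘update′ p≢z S b))
                        (cong (λ v → sum (λ p → h p (lookup S p)) + h z v) (lookup∘update z S b))

drop-⊆ : ∀ {n} (S : Subset n) y → S [ y ]≔ false ⊆ S
drop-⊆ S y {p} p∈S′ with p Fin.≟ y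
... | yes refl = contradiction (trans (sym ([]=⇒lookup p∈S′)) (lookup∘update y S false)) λ ()
... | no p≢y   = lookup⇒[]= p S (trans (sym (lookup∘update′ p≢y S false)) ([]=⇒lookup p∈S′))

exchange-⊆ : ∀ {n} (S : Subset n) x y → lookup S y ≡ true →
  (((S [ x ]≔ true) [ y ]≔ false) ─ ⁅ x ⁆) ∪ ⁅ y ⁆ ⊆ S
exchange-⊆ S x y y∈S {p} p∈ with x∈p∪q⁻ _ ⁅ y ⁆ p∈
... | inj₂ p∈⁅y⁆ rewrite x∈⁅y⁆⇒x≡y y p∈⁅y⁆ = lookup⇒[]= y S y∈S
... | inj₁ p∈S″─x with ∈─⁻ _ ⁅ x ⁆ p∈S″─x
...   | p∈S″ , p∉⁅x⁆ = drop-⊆ S x (lookup⇒[]= p _ (begin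
  lookup (S [ x ]≔ false) p ≡⟨ lookup∘update′ p≢x S false ⟩
  lookup S p                ≡⟨ lookup∘update′ p≢x S true ⟨
  lookup (S [ x ]≔ true) p  ≡⟨ []=⇒lookup (drop-⊆ (S [ x ]≔ true) y p∈S″) ⟩
  true                      ∎))
  where
  open ≡-Reasoning
  p≢x : p ≢ x
  p≢x refl = p∉⁅x⁆ (x∈⁅x⁆ x)

⋂-excludes : ∀ {n} (G : SimpleGame n) {S Ss p} → S ∈ₗ Ss → p ∉ S → p ∉ ⋂ G Ss
⋂-excludes G {Ss = S ∷ Ss}  (Any.here refl) p∉S p∈⋂ = p∉S (proj₁ (x∈p∩q⁻ S _ p∈⋂))
⋂-excludes G {Ss = S′ ∷ Ss} (Any.there S∈)  p∉S p∈⋂ = ⋂-excludes G S∈ p∉S (proj₂ (x∈p∩q⁻ S′ _ p∈⋂))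

colourComplement : ∀ {n k} → (Fin n → Fin k) → Fin k → Subset n
colourComplement a c = tabulate λ p → not (isYes (a p Fin.≟ c))

⋂-colourComplements : ∀ {n k} (G : SimpleGame n) (a : Fin n → Fin k) → ⋂ G (map (colourComplement a) (allFin k)) ≡ ⊥
⋂-colourComplements G a = Empty-unique λ (p , p∈⋂) →
  ⋂-excludes G (∈-map⁺ (colourComplement a) (∈-allFin (a p))) ownColour p∈⋂
  where
  ownColour : ∀ {p} → p ∉ colourComplement a (a p)
  ownColour {p} p∈ with a p Fin.≟ a p | trans (sym ([]=⇒lookup p∈)) (lookup∘tabulate _ p)
  ... | yes _ | ()
  ... | no a≢a | _ = a≢a refl

module _ {n t : ℕ} (cls : Fin n → Fin t) where

  ceilDiv-suc : ∀ a r → ceilDiv cls a (suc r) ≡ (a + r) / suc r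
  ceilDiv-suc a r = cong (λ u → (u ∸ 1) / suc r) (+-suc a r)

  ceilDiv-≤ : ∀ a r k → ceilDiv cls a (suc r) ≤ k ⇔ a ≤ k * suc r
  ceilDiv-≤ a r k rewrite ceilDiv-suc a r = mk⇔ to from
    where
    open ≤-Reasoning
    to : (a + r) / suc r ≤ k → a ≤ k * suc r
    to q≤k = +-cancelʳ-≤ r a (k * suc r) (begin
      a + r                                  ≡⟨ m≡m%n+[m/n]*n (a + r) (suc r) ⟩
      (a + r) % suc r + (a + r) / suc r * suc r ≤⟨ +-mono-≤ (≤-pred (m%n<n (a + r) (suc r))) (*-monoˡ-≤ (suc r) q≤k) ⟩
      r + k * suc r                          ≡⟨ +-comm r _ ⟩
      k * suc r + r                          ∎)
    from : a ≤ k * suc r → (a + r) / suc r ≤ k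
    from a≤ = ≤-pred (m<n*o⇒m/o<n (begin-strict
      a + r                 ≤⟨ +-monoˡ-≤ r a≤ ⟩
      k * suc r + r         <⟨ +-monoʳ-< (k * suc r) (n<1+n r) ⟩
      k * suc r + suc r     ≡⟨ +-comm (k * suc r) (suc r) ⟩
      suc k * suc r         ∎))

  classSize≡sum : ∀ j → classSize cls j ≡ sum λ p → bit (isYes (cls p Fin.≟ j))
  classSize≡sum j = trans (size≡sum (classSet cls j))
                          (sum-cong-≗ λ p → cong bit (lookup∘tabulate (λ i → isYes (cls i Fin.≟ j)) p))

  classSize≡fibre : ∀ j → classSize cls j ≡ fibre cls j
  classSize≡fibre j = trans (classSize≡sum j) (sum-cong-≗ λ p → bit-isYes (cls p Fin.≟ j))

  sum-byClass : ∀ (g : Fin t → ℕ) → sum (λ j → g j * classSize cls j) ≡ sum (λ p → g (cls p))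
  sum-byClass g = begin
    sum (λ j → g j * classSize cls j)              ≡⟨ sum-cong-≗ (λ j → cong (g j *_) (classSize≡fibre j)) ⟩
    sum (λ j → g j * fibre cls j)                  ≡⟨ sum-cong-≗ (λ j → *-distribˡ-sum (g j) (λ p → 𝟙 (cls p Fin.≟ j))) ⟩
    sum (λ j → sum λ p → g j * 𝟙 (cls p Fin.≟ j))  ≡⟨ ∑-comm (λ j p → g j * 𝟙 (cls p Fin.≟ j)) ⟩
    sum (λ p → sum λ j → g j * 𝟙 (cls p Fin.≟ j))
      ≡⟨ sum-cong-≗ (λ p → trans (sum-cong-≗ λ j → *-comm (g j) _) (sum-select (cls p) g)) ⟩
    sum (λ p → g (cls p))                          ∎
    where open ≡-Reasoning

  prefixSum≡below : ∀ i → prefixSum cls i ≡ below (toℕ ∘ cls) i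
  prefixSum≡below i = begin
    prefixSum cls i
      ≡⟨ foldr-filter (λ j → toℕ j <? i) (classSize cls) (allFin t) ⟩
    foldr _+_ 0 (map (λ j → 𝟙 (toℕ j <? i) * classSize cls j) (allFin t))
      ≡⟨ foldr-allFin (λ j → 𝟙 (toℕ j <? i) * classSize cls j) ⟩
    sum (λ j → 𝟙 (toℕ j <? i) * classSize cls j)
      ≡⟨ sum-byClass (λ j → 𝟙 (toℕ j <? i)) ⟩
    below (toℕ ∘ cls) i ∎
    where open ≡-Reasoning

  below≤maxBound* : ∀ p → below (toℕ ∘ cls) (suc (toℕ (cls p))) ≤ maxBound cls * suc (toℕ (cls p))
  below≤maxBound* p = subst (_≤ maxBound cls * suc (toℕ (cls p))) (prefixSum≡below _)
    (Equivalence.to (ceilDiv-≤ _ _ _)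
      (≤-max-upTo (λ r → ceilDiv cls (prefixSum cls (suc r)) (suc r)) (Fin.toℕ<n (cls p))))

  module _ (onto : ∀ j → ∃ λ p → cls p ≡ j) where

    t≤n : t ≤ n
    t≤n = Fin.injective⇒≤ {f = proj₁ ∘ onto} λ {i} {j} e →
      trans (sym (proj₂ (onto i))) (trans (cong cls e) (proj₂ (onto j)))

    classSize-pos : ∀ j → 1 ≤ classSize cls j
    classSize-pos j = begin
      1                   ≡⟨ 𝟙-yes (cls p Fin.≟ j) (proj₂ (onto j)) ⟨
      𝟙 (cls p Fin.≟ j)   ≤⟨ ≤-sum (λ q → 𝟙 (cls q Fin.≟ j)) p ⟩
      fibre cls j         ≡⟨ classSize≡fibre j ⟨
      classSize cls j     ∎
      where
      open ≤-Reasoning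
      p : Fin n
      p = proj₁ (onto j)

    below+[t∸s]≤n : ∀ s → below (toℕ ∘ cls) s + (t ∸ s) ≤ n
    below+[t∸s]≤n s = begin
      below (toℕ ∘ cls) s + (t ∸ s)
        ≤⟨ +-monoʳ-≤ (below (toℕ ∘ cls) s) (t∸s≤#[s≤] t s) ⟩
      below (toℕ ∘ cls) s + sum {t} (λ j → 𝟙 (s ≤? toℕ j))
        ≤⟨ +-monoʳ-≤ (below (toℕ ∘ cls) s) (sum-mono-≤ λ j →
             subst (_≤ 𝟙 (s ≤? toℕ j) * classSize cls j) (*-identityʳ _) (*-monoʳ-≤ (𝟙 (s ≤? toℕ j)) (classSize-pos j))) ⟩
      below (toℕ ∘ cls) s + sum (λ j → 𝟙 (s ≤? toℕ j) * classSize cls j)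
        ≡⟨ cong (_+ sum (λ j → 𝟙 (s ≤? toℕ j) * classSize cls j)) (sum-byClass (λ j → 𝟙 (toℕ j <? s))) ⟨
      sum (λ j → 𝟙 (toℕ j <? s) * classSize cls j) + sum (λ j → 𝟙 (s ≤? toℕ j) * classSize cls j)
        ≡⟨ ∑-distrib-+ (λ j → 𝟙 (toℕ j <? s) * classSize cls j) (λ j → 𝟙 (s ≤? toℕ j) * classSize cls j) ⟨
      sum (λ j → 𝟙 (toℕ j <? s) * classSize cls j + 𝟙 (s ≤? toℕ j) * classSize cls j)
        ≡⟨ sum-cong-≗ (λ j → trans (sym (*-distribʳ-+ (classSize cls j) (𝟙 (toℕ j <? s)) _))
                                   (trans (cong (_* classSize cls j) (𝟙-<+𝟙-≥ (toℕ j) s)) (*-identityˡ _))) ⟩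
      sum (classSize cls)
        ≡⟨ trans (sum-cong-≗ classSize≡fibre) (sum-fibre cls) ⟩
      n ∎
      where open ≤-Reasoning

    below≤n∸t+s : ∀ s → s ≤ t → below (toℕ ∘ cls) s ≤ n ∸ t + s
    below≤n∸t+s s s≤t = +-cancelʳ-≤ (t ∸ s) _ _ (begin
      below (toℕ ∘ cls) s + (t ∸ s)  ≤⟨ below+[t∸s]≤n s ⟩
      n                              ≡⟨ m∸n+n≡m t≤n ⟨
      n ∸ t + t                      ≡⟨ cong (n ∸ t +_) (m+[n∸m]≡n s≤t) ⟨
      n ∸ t + (s + (t ∸ s))          ≡⟨ +-assoc (n ∸ t) s (t ∸ s) ⟨
      n ∸ t + s + (t ∸ s)            ∎)
      where open ≤-Reasoning

    maxBound≤n∸t+1 : maxBound cls ≤ n ∸ t + 1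
    maxBound≤n∸t+1 = max-upTo-≤ _ t λ {r} r<t → Equivalence.from (ceilDiv-≤ _ r _) (begin
      prefixSum cls (suc r)        ≡⟨ prefixSum≡below (suc r) ⟩
      below (toℕ ∘ cls) (suc r)    ≤⟨ below≤n∸t+s (suc r) r<t ⟩
      n ∸ t + suc r                ≤⟨ +-monoˡ-≤ (suc r) (m≤m*n (n ∸ t) (suc r)) ⟩
      (n ∸ t) * suc r + suc r      ≡⟨ cong ((n ∸ t) * suc r +_) (*-identityˡ (suc r)) ⟨
      (n ∸ t) * suc r + 1 * suc r  ≡⟨ *-distribʳ-+ (suc r) (n ∸ t) 1 ⟨
      (n ∸ t + 1) * suc r          ∎)
      where open ≤-Reasoning

module _ {n : ℕ} (G : SimpleGame n) where

  open SimpleGame G using (W)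

  Excluding : ℕ → Subset n → Set
  Excluding k X = ∃ λ Ss → length Ss ≡ k × All (Winning G) Ss × X ∩ ⋂ G Ss ≡ ⊥

  excluding? : ∀ k X → Dec (Excluding k X)
  excluding? zero X with ≡-dec Bool._≟_ (X ∩ ⊤) ⊥
  ... | yes X∩⊤≡⊥ = yes ([] , refl , [] , X∩⊤≡⊥)
  ... | no  X∩⊤≢⊥ = no λ { ([] , _ , _ , X∩⊤≡⊥) → X∩⊤≢⊥ X∩⊤≡⊥ }
  excluding? (suc k) X with anySubset? (λ S → (W S Bool.≟ true) ×-dec excluding? k (X ∩ S))
  ... | yes (S , w , Ss , l , ws , e) =
    yes (S ∷ Ss , cong suc l , w ∷ ws , trans (sym (∩-assoc X S (⋂ G Ss))) e)
  ... | no none = no λ { (S ∷ Ss , l , w ∷ ws , e) →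
    none (S , w , Ss , suc-injective l , ws , trans (∩-assoc X S (⋂ G Ss)) e) }

  ν-exists : ∀ Ss → All (Winning G) Ss → ⋂ G Ss ≡ ⊥ → ∃ λ ν → IsNu G ν × ν ≤ length Ss
  ν-exists Ss ws e with leastBelow (λ k → excluding? k ⊤) (suc (length Ss))
  ... | inj₂ none = contradiction (Ss , refl , ws , trans (∩-identityˡ _) e) (none (n<1+n _))
  ... | inj₁ (ν , ν≤ , (Ts , l , ws′ , e′) , least) =
    ν , ((Ts , l , ws′ , trans (sym (∩-identityˡ _)) e′) , minimal) , ≤-pred ν≤
    where
    minimal : ∀ Us → All (Winning G) Us → ⋂ G Us ≡ ⊥ → ν ≤ length Us
    minimal Us wu eu = ≮⇒≥ λ lt → least lt (Us , refl , wu , trans (∩-identityˡ _) eu)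

module _ {n t : ℕ} (G : SimpleGame n) (cls : Fin n → Fin t) where

  open SimpleGame G using (superset-closed)

  cl : Fin n → ℕ
  cl = toℕ ∘ cls

  absent : Subset n → Fin n → ℕ
  absent S p = bit (not (lookup S p))

  missingBelow : Subset n → ℕ → ℕ
  missingBelow S i = sum λ p → 𝟙 (cl p <? i) * absent S p

  missingIn : Subset n → ℕ → ℕ
  missingIn S q = sum λ p → 𝟙 (cl p ℕ.≟ q) * absent S p

  FewMissing : Subset n → Set
  FewMissing S = ∀ i → i ≤ t → missingBelow S i ≤ i

  weight : Subset n → ℕ
  weight S = sum λ p → if lookup S p then t else cl p

  missingBelow-zero : ∀ S → missingBelow S 0 ≡ 0
  missingBelow-zero S = trans (sum-cong-≗ λ p → cong (_* absent S p) (𝟙-no (cl p <? 0) λ ()))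
                              (trans (sum-const {n} 0) (*-zeroʳ n))

  missingBelow-suc : ∀ S q → missingBelow S (suc q) ≡ missingBelow S q + missingIn S q
  missingBelow-suc S q = trans
    (sum-cong-≗ λ p → trans (cong (_* absent S p) (𝟙-<-suc (cl p) q)) (*-distribʳ-+ (absent S p) (𝟙 (cl p <? q)) (𝟙 (cl p ℕ.≟ q))))
    (∑-distrib-+ (λ p → 𝟙 (cl p <? q) * absent S p) (λ p → 𝟙 (cl p ℕ.≟ q) * absent S p))

  missingBelow-gap : ∀ S {i i′} → missingBelow S i < missingBelow S i′ →
                     ∃ λ p → i ≤ cl p × cl p < i′ × lookup S p ≡ false
  missingBelow-gap S {i} {i′} lt
    with Fin.any? (λ p → (i ≤? cl p) ×-dec (cl p <? i′) ×-dec (lookup S p Bool.≟ false))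
  ... | yes found = found
  ... | no none   = contradiction (sum-mono-≤ pointwise) (<⇒≱ lt)
    where
    pointwise : ∀ p → 𝟙 (cl p <? i′) * absent S p ≤ 𝟙 (cl p <? i) * absent S p
    pointwise p with i ≤? cl p
    ... | no cl≱i  = *-monoˡ-≤ (absent S p) (𝟙-mono (cl p <? i′) (cl p <? i) λ _ → ≰⇒> cl≱i)
    ... | yes i≤cl = ≤-trans (≤-reflexive (vanish (cl p <? i′))) z≤n
      where
      vanish : (d : Dec (cl p < i′)) → 𝟙 d * absent S p ≡ 0
      vanish (no _)       = refl
      vanish (yes cl<i′) = cong (λ b → 1 * bit (not b)) (¬-not λ eq → none (p , i≤cl , cl<i′ , eq))

  missingBelow-drop : ∀ S y i → lookup S y ≡ true →
                      missingBelow (S [ y ]≔ false) i ≡ missingBelow S i + 𝟙 (cl y <? i)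
  missingBelow-drop S y i y∈S = begin
    missingBelow (S [ y ]≔ false) i
      ≡⟨ +-identityʳ _ ⟨
    missingBelow (S [ y ]≔ false) i + 0
      ≡⟨ cong (missingBelow (S [ y ]≔ false) i +_) (*-zeroʳ (𝟙 (cl y <? i))) ⟨
    missingBelow (S [ y ]≔ false) i + 𝟙 (cl y <? i) * 0
      ≡⟨ cong (λ b → missingBelow (S [ y ]≔ false) i + 𝟙 (cl y <? i) * bit (not b)) y∈S ⟨
    missingBelow (S [ y ]≔ false) i + 𝟙 (cl y <? i) * absent S y
      ≡⟨ sum-[]≔ (λ p b → 𝟙 (cl p <? i) * bit (not b)) S y false ⟩
    missingBelow S i + 𝟙 (cl y <? i) * 1
      ≡⟨ cong (missingBelow S i +_) (*-identityʳ _) ⟩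
    missingBelow S i + 𝟙 (cl y <? i) ∎
    where open ≡-Reasoning

  missingBelow-add : ∀ S x i → lookup S x ≡ false →
                     missingBelow (S [ x ]≔ true) i + 𝟙 (cl x <? i) ≡ missingBelow S i
  missingBelow-add S x i x∉S = begin
    missingBelow (S [ x ]≔ true) i + 𝟙 (cl x <? i)
      ≡⟨ cong (λ b → missingBelow (S [ x ]≔ true) i + b) (*-identityʳ _) ⟨
    missingBelow (S [ x ]≔ true) i + 𝟙 (cl x <? i) * 1
      ≡⟨ cong (λ b → missingBelow (S [ x ]≔ true) i + 𝟙 (cl x <? i) * bit (not b)) x∉S ⟨
    missingBelow (S [ x ]≔ true) i + 𝟙 (cl x <? i) * absent S x
      ≡⟨ sum-[]≔ (λ p b → 𝟙 (cl p <? i) * bit (not b)) S x true ⟩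
    missingBelow S i + 𝟙 (cl x <? i) * 0
      ≡⟨ cong (missingBelow S i +_) (*-zeroʳ (𝟙 (cl x <? i))) ⟩
    missingBelow S i + 0
      ≡⟨ +-identityʳ _ ⟩
    missingBelow S i ∎
    where open ≡-Reasoning

  weight-drop : ∀ S y → lookup S y ≡ true → weight (S [ y ]≔ false) + t ≡ weight S + cl y
  weight-drop S y y∈S = trans (cong (λ b → weight (S [ y ]≔ false) + (if b then t else cl y)) (sym y∈S))
                              (sum-[]≔ (λ p b → if b then t else cl p) S y false)

  weight-add : ∀ S x → lookup S x ≡ false → weight (S [ x ]≔ true) + cl x ≡ weight S + t
  weight-add S x x∉S = trans (cong (λ b → weight (S [ x ]≔ true) + (if b then t else cl x)) (sym x∉S))
                             (sum-[]≔ (λ p b → if b then t else cl p) S x true)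

  fewMissing-add : ∀ S x → lookup S x ≡ false → FewMissing S → FewMissing (S [ x ]≔ true)
  fewMissing-add S x x∉S few i i≤t =
    ≤-trans (m≤m+n _ _) (≤-trans (≤-reflexive (missingBelow-add S x i x∉S)) (few i i≤t))

  fewMissing-drop : ∀ S y → lookup S y ≡ true → FewMissing S →
                    (∀ i → cl y < i → i ≤ t → missingBelow S i < i) → FewMissing (S [ y ]≔ false)
  fewMissing-drop S y y∈S few slack i i≤t with cl y <? i
  ... | yes y<i = begin
    missingBelow (S [ y ]≔ false) i   ≡⟨ missingBelow-drop S y i y∈S ⟩
    missingBelow S i + 𝟙 (cl y <? i)  ≡⟨ cong (missingBelow S i +_) (𝟙-yes (cl y <? i) y<i) ⟩
    missingBelow S i + 1              ≡⟨ +-comm _ 1 ⟩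
    suc (missingBelow S i)            ≤⟨ slack i y<i i≤t ⟩
    i                                 ∎
    where open ≤-Reasoning
  ... | no y≮i = begin
    missingBelow (S [ y ]≔ false) i   ≡⟨ missingBelow-drop S y i y∈S ⟩
    missingBelow S i + 𝟙 (cl y <? i)  ≡⟨ cong (missingBelow S i +_) (𝟙-no (cl y <? i) y≮i) ⟩
    missingBelow S i + 0              ≡⟨ +-identityʳ _ ⟩
    missingBelow S i                  ≤⟨ few i i≤t ⟩
    i                                 ∎
    where open ≤-Reasoning

  fewMissing-swap : ∀ S x y → lookup S x ≡ false → lookup S y ≡ true → FewMissing S →
                    (∀ i → cl y < i → i ≤ cl x → missingBelow S i < i) →
                    FewMissing ((S [ x ]≔ true) [ y ]≔ false)
  fewMissing-swap S x y x∉S y∈S few slack =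
    fewMissing-drop (S [ x ]≔ true) y (trans (lookup∘update′ y≢x S true) y∈S) (fewMissing-add S x x∉S few) slack′
    where
    y≢x : y ≢ x
    y≢x refl = contradiction (trans (sym x∉S) y∈S) λ ()
    slack′ : ∀ i → cl y < i → i ≤ t → missingBelow (S [ x ]≔ true) i < i
    slack′ i y<i i≤t with cl x <? i
    ... | yes x<i = +-cancelʳ-≤ 1 _ i (begin
      suc (missingBelow (S [ x ]≔ true) i) + 1 ≡⟨ cong (λ k → suc (missingBelow (S [ x ]≔ true) i + k)) (𝟙-yes (cl x <? i) x<i) ⟨
      suc (missingBelow (S [ x ]≔ true) i + 𝟙 (cl x <? i)) ≡⟨ cong suc (missingBelow-add S x i x∉S) ⟩
      suc (missingBelow S i) ≤⟨ s≤s (few i i≤t) ⟩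
      suc i ≡⟨ +-comm 1 i ⟩
      i + 1 ∎)
      where open ≤-Reasoning
    ... | no x≮i = begin-strict
      missingBelow (S [ x ]≔ true) i                  ≤⟨ m≤m+n _ _ ⟩
      missingBelow (S [ x ]≔ true) i + 𝟙 (cl x <? i)  ≡⟨ missingBelow-add S x i x∉S ⟩
      missingBelow S i                                <⟨ slack i y<i (≮⇒≥ x≮i) ⟩
      i                                               ∎
      where open ≤-Reasoning

  weight-drop-< : ∀ S y → lookup S y ≡ true → weight (S [ y ]≔ false) < weight S
  weight-drop-< S y y∈S = <-from-+≡ (weight-drop S y y∈S) (Fin.toℕ<n (cls y))

  weight-swap-< : ∀ S x y → lookup S x ≡ false → lookup S y ≡ true → cl y < cl x →
                  weight ((S [ x ]≔ true) [ y ]≔ false) < weight S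
  weight-swap-< S x y x∉S y∈S y<x = +-cancelʳ-< t _ _ (<-from-+≡ balance y<x)
    where
    S′ : Subset n
    S′ = S [ x ]≔ true
    y∈S′ : lookup S′ y ≡ true
    y∈S′ = trans (lookup∘update′ (λ { refl → contradiction (trans (sym x∉S) y∈S) λ () }) S true) y∈S
    balance : weight (S′ [ y ]≔ false) + t + cl x ≡ weight S + t + cl y
    balance = begin
      weight (S′ [ y ]≔ false) + t + cl x ≡⟨ cong (_+ cl x) (weight-drop S′ y y∈S′) ⟩
      weight S′ + cl y + cl x              ≡⟨ +-assoc (weight S′) (cl y) (cl x) ⟩
      weight S′ + (cl y + cl x)            ≡⟨ cong (weight S′ +_) (+-comm (cl y) (cl x)) ⟩
      weight S′ + (cl x + cl y)            ≡⟨ +-assoc (weight S′) (cl x) (cl y) ⟨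
      weight S′ + cl x + cl y              ≡⟨ cong (_+ cl y) (weight-add S x x∉S) ⟩
      weight S + t + cl y                  ∎
      where open ≡-Reasoning

  winning-drop : ∀ S y → Winning G (S [ y ]≔ false) → Winning G S
  winning-drop S y = superset-closed _ _ (drop-⊆ S y)

  winning-swap : ∀ S x y → lookup S x ≡ false → lookup S y ≡ true → Desirable G y x →
                 Winning G ((S [ x ]≔ true) [ y ]≔ false) → Winning G S
  winning-swap S x y x∉S y∈S y⊒x w = superset-closed _ _ (exchange-⊆ S x y y∈S) (y⊒x _ x∈S″ y∉S″ w)
    where
    x≢y : x ≢ y
    x≢y refl = contradiction (trans (sym x∉S) y∈S) λ ()
    x∈S″ : x ∈ (S [ x ]≔ true) [ y ]≔ false
    x∈S″ = lookup⇒[]= x _ (trans (lookup∘update′ x≢y (S [ x ]≔ true) false) (lookup∘update x S true))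
    y∉S″ : y ∉ (S [ x ]≔ true) [ y ]≔ false
    y∉S″ y∈ = contradiction (trans (sym ([]=⇒lookup y∈)) (lookup∘update y (S [ x ]≔ true) false)) λ ()

  coalitionVector+missingIn : ∀ S j → coalitionVector cls S j + missingIn S (toℕ j) ≡ classSize cls j
  coalitionVector+missingIn S j = begin
    coalitionVector cls S j + missingIn S (toℕ j)
      ≡⟨ cong (_+ missingIn S (toℕ j)) (trans (size≡sum (S ∩ classSet cls j)) (sum-cong-≗ inter)) ⟩
    sum (λ p → bit (lookup S p ∧ c p)) + missingIn S (toℕ j)
      ≡⟨ ∑-distrib-+ (λ p → bit (lookup S p ∧ c p)) (λ p → 𝟙 (cl p ℕ.≟ toℕ j) * absent S p) ⟨
    sum (λ p → bit (lookup S p ∧ c p) + 𝟙 (cl p ℕ.≟ toℕ j) * absent S p)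
      ≡⟨ sum-cong-≗ (λ p → trans (cong (λ k → bit (lookup S p ∧ c p) + k * absent S p) (inClass p))
                                 (bit-∧-split (lookup S p) (c p))) ⟩
    sum (λ p → bit (c p))
      ≡⟨ classSize≡sum cls j ⟨
    classSize cls j ∎
    where
    open ≡-Reasoning
    c : Fin n → Bool
    c p = isYes (cls p Fin.≟ j)
    inter : ∀ p → bit (lookup (S ∩ classSet cls j) p) ≡ bit (lookup S p ∧ c p)
    inter p = cong bit (trans (lookup-zipWith _∧_ p S (classSet cls j)) (cong (lookup S p ∧_) (lookup∘tabulate c p)))
    inClass : ∀ p → 𝟙 (cl p ℕ.≟ toℕ j) ≡ bit (c p)
    inClass p = trans (𝟙-cong (cl p ℕ.≟ toℕ j) (cls p Fin.≟ j) Fin.toℕ-injective (cong toℕ)) (sym (bit-isYes _))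

  ¬slack⇒tight : ∀ S → FewMissing S → ∀ {r} → r < t → ¬ missingBelow S (suc r) ≤ r → missingBelow S (suc r) ≡ suc r
  ¬slack⇒tight S few r<t slack = ≤-antisym (few _ r<t) (≰⇒> slack)

  noSlack⇒tight : ∀ S → FewMissing S → ∀ {q} → q ≤ t → (∀ {r} → r < q → ¬ missingBelow S (suc r) ≤ r) →
               missingBelow S q ≡ q
  noSlack⇒tight S few {zero}  _   _     = missingBelow-zero S
  noSlack⇒tight S few {suc r} q≤t lower = ¬slack⇒tight S few q≤t (lower (n<1+n r))

  missingBelow-suc-tight : ∀ S q → missingBelow S q ≡ q → q + missingIn S q ≡ missingBelow S (suc q)
  missingBelow-suc-tight S q mq = trans (cong (_+ missingIn S q) (sym mq)) (sym (missingBelow-suc S q))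

  missingIn≡0⇒present : ∀ S {q} y → missingIn S q ≡ 0 → cl y ≡ q → lookup S y ≡ true
  missingIn≡0⇒present S {q} y none cly = ¬-not λ y∉S → contradiction (begin-strict
    0                                        <⟨ s≤s z≤n ⟩
    1                                        ≡⟨ cong (_* 1) (𝟙-yes (cl y ℕ.≟ q) cly) ⟨
    𝟙 (cl y ℕ.≟ q) * bit (not false)         ≡⟨ cong (λ b → 𝟙 (cl y ℕ.≟ q) * bit (not b)) y∉S ⟨
    𝟙 (cl y ℕ.≟ q) * absent S y              ≤⟨ ≤-sum (λ p → 𝟙 (cl p ℕ.≟ q) * absent S p) y ⟩
    missingIn S q                            ≡⟨ none ⟩
    0                                        ∎) (<-irrefl refl)
    where open ≤-Reasoning

  allTight⇒oneMissing : ∀ S → FewMissing S → (∀ {r} → r < t → ¬ missingBelow S (suc r) ≤ r) →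
                        ∀ j → coalitionVector cls S j ≡ classSize cls j ∸ 1
  allTight⇒oneMissing S few allTight j = begin
    coalitionVector cls S j           ≡⟨ m+n∸n≡m _ 1 ⟨
    coalitionVector cls S j + 1 ∸ 1   ≡⟨ cong (λ k → coalitionVector cls S j + k ∸ 1) one ⟨
    coalitionVector cls S j + missingIn S q ∸ 1 ≡⟨ cong (_∸ 1) (coalitionVector+missingIn S j) ⟩
    classSize cls j ∸ 1               ∎
    where
    open ≡-Reasoning
    q : ℕ
    q = toℕ j
    q<t : q < t
    q<t = Fin.toℕ<n j
    one : missingIn S q ≡ 1
    one = +-cancelˡ-≡ q _ _ (begin
      q + missingIn S q       ≡⟨ missingBelow-suc-tight S q (noSlack⇒tight S few (<⇒≤ q<t) (allTight ∘ λ r<q → <-trans r<q q<t)) ⟩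
      missingBelow S (suc q)  ≡⟨ ¬slack⇒tight S few q<t (allTight q<t) ⟩
      suc q                   ≡⟨ +-comm 1 q ⟩
      q + 1                   ∎)

  missingBelow-colourComplement : ∀ {k} (a : Fin n → Fin k) c i →
                                  missingBelow (colourComplement a c) i ≡ colouredBelow cl a c i
  missingBelow-colourComplement a c i = sum-cong-≗ λ p → cong (𝟙 (cl p <? i) *_) (begin
    absent (colourComplement a c) p         ≡⟨ cong (bit ∘ not) (lookup∘tabulate (λ q → not (isYes (a q Fin.≟ c))) p) ⟩
    bit (not (not (isYes (a p Fin.≟ c))))  ≡⟨ cong bit (not-involutive _) ⟩
    bit (isYes (a p Fin.≟ c))              ≡⟨ bit-isYes (a p Fin.≟ c) ⟩
    𝟙 (a p Fin.≟ c)                        ∎)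
    where open ≡-Reasoning

  Reduction : Subset n → Set
  Reduction S = ∃ λ S′ → weight S′ < weight S × FewMissing S′ × (Winning G S′ → Winning G S)

  module _ (shift : ∀ p q → cl p ≤ cl q → Desirable G p q) where

    -- Drop y, unless some prefix count above class cl y is tight: then swap y with an
    -- absent player x below the first such prefix.
    reduce : ∀ S y → lookup S y ≡ true → FewMissing S → missingBelow S (suc (cl y)) ≤ cl y → Reduction S
    reduce S y y∈S few slack with leastBelow (λ i → (suc (cl y) ≤? i) ×-dec (i ≤? missingBelow S i)) (suc t)
    ... | inj₂ noTight =
      S [ y ]≔ false , weight-drop-< S y y∈S , fewMissing-drop S y y∈S few notTight , winning-drop S y
      where
      notTight : ∀ i → cl y < i → i ≤ t → missingBelow S i < i
      notTight i y<i i≤t = ≰⇒> λ i≤m → noTight (s≤s i≤t) (y<i , i≤m)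
    ... | inj₁ (i , _ , (y<i , i≤m) , lower)
      with missingBelow-gap S (<-≤-trans (≤-<-trans slack y<i) i≤m)
    ...   | x , y<x , x<i , x∉S =
      (S [ x ]≔ true) [ y ]≔ false , weight-swap-< S x y x∉S y∈S y<x ,
      fewMissing-swap S x y x∉S y∈S few (λ r y<r r≤x → ≰⇒> λ r≤m → lower (≤-<-trans r≤x x<i) (y<r , r≤m)) ,
      winning-swap S x y x∉S y∈S (shift y x (<⇒≤ y<x))

    module _ (onto : ∀ j → ∃ λ p → cls p ≡ j)
             (oneMissingWins : WinningVector G cls (λ j → classSize cls j ∸ 1)) where

      fewMissing⇒winning : ∀ S → FewMissing S → Winning G S
      fewMissing⇒winning = WF.All.wfRec (On.wellFounded weight <-wellFounded) _ (λ S → FewMissing S → Winning G S) step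
        where
        -- The least class q with slack has no absent player, so a present y can be moved.
        step : ∀ S → (∀ {S′} → weight S′ < weight S → FewMissing S′ → Winning G S′) → FewMissing S → Winning G S
        step S ih few with leastBelow (λ q → missingBelow S (suc q) ≤? q) t
        ... | inj₂ allTight = oneMissingWins S (allTight⇒oneMissing S few allTight)
        ... | inj₁ (q , q<t , slack , lower) =
          let S′ , lighter , few′ , back = reduce S y y∈S few (subst (λ k → missingBelow S (suc k) ≤ k) (sym cly) slack)
          in back (ih lighter few′)
          where
          y : Fin n
          y = proj₁ (onto (fromℕ< q<t))
          cly : cl y ≡ q
          cly = trans (cong toℕ (proj₂ (onto (fromℕ< q<t)))) (Fin.toℕ-fromℕ< q<t)
          noneMissing : missingIn S q ≡ 0
          noneMissing = n≤0⇒n≡0 (+-cancelˡ-≤ q _ 0 (begin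
            q + missingIn S q       ≡⟨ missingBelow-suc-tight S q (noSlack⇒tight S few (<⇒≤ q<t) lower) ⟩
            missingBelow S (suc q)  ≤⟨ slack ⟩
            q                       ≡⟨ +-identityʳ q ⟨
            q + 0                   ∎))
            where open ≤-Reasoning
          y∈S : lookup S y ≡ true
          y∈S = missingIn≡0⇒present S y noneMissing cly

      ν≤colours : ∀ {k} (a : Fin n → Fin k) → (∀ c i → colouredBelow cl a c i ≤ i) → ∃ λ ν → IsNu G ν × ν ≤ k
      ν≤colours {k} a few =
        let ν , isNu , ν≤ = ν-exists G Cs complementsWin (⋂-colourComplements G a)
        in  ν , isNu , ≤-trans ν≤ (≤-reflexive (trans (length-map _ (allFin k)) (length-tabulate _)))
        where
        Cs : List (Subset n)
        Cs = map (colourComplement a) (allFin k)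
        complementsWin : All (Winning G) Cs
        complementsWin = Allₚ.map⁺ (Allₚ.tabulate⁺ λ c → fewMissing⇒winning (colourComplement a c) λ i _ →
          subst (_≤ i) (sym (missingBelow-colourComplement a c i)) (few c i))

-- Completeness enters only through the characterisation of ⊒ by cls.
corollary1 : (n t : ℕ) (G : SimpleGame n)
    → IsTotalPreorder _≡_ (Desirable G)
    → (cls : Fin n → Fin t)
    → Surjective _≡_ _≡_ cls
    → (∀ i j → (cls i Data.Fin.≤ cls j) ⇔ Desirable G i j)
    → WinningVector G cls (λ j → classSize cls j ∸ 1)
    → Σ ℕ λ ν → IsNu G ν × ν ≤ maxBound cls × maxBound cls ≤ n ∸ t + 1
corollary1 n t G _ cls onto desirability oneMissingWins =
  let a , fewPerColour = colouring (maxBound cls) (toℕ ∘ cls) (below≤maxBound* cls)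
      ν , isNu , ν≤k   = ν≤colours G cls shift onto′ oneMissingWins a fewPerColour
  in  ν , isNu , ν≤k , maxBound≤n∸t+1 cls onto′
  where
  onto′ : ∀ j → ∃ λ p → cls p ≡ j
  onto′ j = proj₁ (onto j) , proj₂ (onto j) refl
  shift : ∀ p q → toℕ (cls p) ≤ toℕ (cls q) → Desirable G p q
  shift p q = Equivalence.to (desirability p q)
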